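{- Let $n\ge1$, $h\ge1$, $0\le\bar w\le n$, let $H$ be a multiset of $h$ binary strings each of length $n$ and weight $\bar w$, let $M=M(H)$, and let $f$ be a cumulative weight function that is a solution to $M$ and satisfies conditions (C1) and (C2). If the functions $f_m$, $m\in A(\bar w/2)$, are not all the same, then there exists $m_1\in A(\bar w/2)$ such that there are exactly two maximal intervals between $f_{m_1}$ and $f_{m_1^*}$, and the functions $f_m$, $m\in A(\bar w/2)\setminus\{m_1,m_1^*\}$, are all the same. Moreover, either $\mathcal{G}(f_m,[\lfloor n/2\rfloor])=\mathcal{G}(f_{m_1},[\lfloor n/2\rfloor])$ for all $m\in A(\bar w/2)\setminus\{m_1,m_1^*\}$, or $\mathcal{G}(f_m,[\lfloor n/2\rfloor])=\mathcal{G}(f_{m_1^*},[\lfloor n/2\rfloor])$ for all $m\in A(\bar w/2)\setminus\{m_1,m_1^*\}$.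
   Context: Notation: $[n]=\{1,\dots,n\}$; $[n_1,n_2]=\{n_1,\dots,n_2\}$ if $n_1\le n_2$, else $\emptyset$. For a binary string $t$ of length $n$, $\mathrm{wt}(t)$ is its number of ones, $t[l]$, $t[-l]$ its length-$l$ prefix and suffix; $M(t)$ is the multiset union of $\{(j-\mathrm{wt}(t[j]),\mathrm{wt}(t[j])) : j\in[n]\}$ and $\{(j-\mathrm{wt}(t[-j]),\mathrm{wt}(t[-j])) : j\in[n]\}$, and $M(H)$ is the multiset union of $M(t)$, $t\in H$. A cumulative weight function (CWF) is $f:\{0,\dots,n\}\times[2h]\to\{0,\dots,n\}$ with (a) $f(0,m)=0$; (b) $f(l,m)-f(l-1,m)\in\{0,1\}$ for $(l,m)\in[n]\times[2h]$; (c) for each $j\in[h]$ there is $w_j$ with $f(l,2j-1)+f(n-l,2j)=w_j$ for all $l\in\{0,\dots,n\}$. Write $f_m(l)=f(l,m)$; $m^*=m-1$ if $m$ is even, $m^*=m+1$ if $m$ is odd. $f$ is a solution to $M$ if $M=\{(l-f_m(l),f_m(l)): m\in[2h],l\in[n]\}$ as multisets. $D(m_1,m_2)=\{l\in[n]:f_{m_1}(l)\ne f_{m_2}(l)\}$; a nonempty $[k_1,k_2]\subset[n]$ is a maximal interval between $f_{m_1}$ and $f_{m_2}$ if $[k_1,k_2]\subset D(m_1,m_2)$ and $k_1-1,k_2+1\notin D(m_1,m_2)$. Condition (C1): for any $m_1,m_2\in[2h]$ with $m_1^*=m_2$ there are at most two maximal intervals between $f_{m_1}$ and $f_{m_2}$.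 Condition (C2): for any $m_1,m_2\in[2h]$ with $m_1^*\ne m_2$ there is at most one maximal interval between $f_{m_1}$ and $f_{m_2}$. $\mathrm{med}(f_m)=\frac12(f_m(\lfloor n/2\rfloor)+f_m(\lceil n/2\rceil))$ and $A(w)=\{m\in[2h]:\mathrm{med}(f_m)=w\}$. For $I\subset\{0,\dots,n\}$, $\mathcal{G}(f_m,I)=\{(l,f_m(l)):l\in I\}$ is the graph of $f_m$ over $I$. -}

module Defs where

open import Data.Nat using (ℕ; zero; suc; _+_; _*_; _∸_; _≤_; _/_)
open import Data.Bool using (Bool; true; false; if_then_else_)
open import Data.List using (List; []; _∷_; map; upTo; concatMap; take; drop; length)
open import Data.List.Relation.Binary.Permutation.Propositional using (_↭_)
open import Data.Vec using (Vec; toList)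
open import Data.Product using (_×_; _,_; ∃)
open import Data.Sum using (_⊎_)
open import Relation.Binary.PropositionalEquality using (_≡_; _≢_)
open import Relation.Nullary using (¬_)

wt : List Bool → ℕ
wt [] = 0
wt (true ∷ xs) = suc (wt xs)
wt (false ∷ xs) = wt xs

-- [n1 , n2] as a list (empty if n1 > n2); [ n ] = [1 , n]
range : ℕ → ℕ → List ℕ
range a b = map (a +_) (upTo (suc b ∸ a))

prefix : ∀ {n} → ℕ → Vec Bool n → List Bool
prefix l t = take l (toList t)

suffix : ∀ {n} → ℕ → Vec Bool n → List Bool
suffix {n} l t = drop (n ∸ l) (toList t)

Mstr : ∀ {n} → Vec Bool n → List (ℕ × ℕ)
Mstr {n} t =
  concatMap (λ j → (j ∸ wt (prefix j t) , wt (prefix j t))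
                 ∷ (j ∸ wt (suffix j t) , wt (suffix j t)) ∷ []) (range 1 n)

-- M(H) for H a multiset of h strings (given as a vector; order irrelevant)
MH : ∀ {n h} → Vec (Vec Bool n) h → List (ℕ × ℕ)
MH H = concatMap Mstr (toList H)

-- Cumulative weight functions.  f l m = f(l,m), with m ∈ [2h] 1-based.

CWF : (n h : ℕ) → (ℕ → ℕ → ℕ) → Set
CWF n h f =
  -- codomain {0,...,n}
  (∀ l m → l ≤ n → 1 ≤ m → m ≤ 2 * h → f l m ≤ n)
  × (∀ m → 1 ≤ m → m ≤ 2 * h → f 0 m ≡ 0)
  × (∀ l m → 1 ≤ l → l ≤ n → 1 ≤ m → m ≤ 2 * h →
       (f l m ≡ f (l ∸ 1) m) ⊎ (f l m ≡ suc (f (l ∸ 1) m)))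
  × (∀ j → 1 ≤ j → j ≤ h →
       ∃ λ w → ∀ l → l ≤ n → f l (2 * j ∸ 1) + f (n ∸ l) (2 * j) ≡ w)

isEven : ℕ → Bool
isEven zero = true
isEven (suc zero) = false
isEven (suc (suc m)) = isEven m

star : ℕ → ℕ
star m = if isEven m then m ∸ 1 else suc m

Mf : (n h : ℕ) → (ℕ → ℕ → ℕ) → List (ℕ × ℕ)
Mf n h f = concatMap (λ m → map (λ l → (l ∸ f l m , f l m)) (range 1 n)) (range 1 (2 * h))

-- f is a solution to M (equality of multisets = permutation of lists)
IsSolution : (n h : ℕ) → (ℕ → ℕ → ℕ) → List (ℕ × ℕ) → Set
IsSolution n h f M = M ↭ Mf n h f

InD : (n : ℕ) → (ℕ → ℕ → ℕ) → ℕ → ℕ → ℕ → Set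
InD n f m1 m2 l = (1 ≤ l) × (l ≤ n) × (f l m1 ≢ f l m2)

MaxInterval : (n : ℕ) → (ℕ → ℕ → ℕ) → ℕ → ℕ → ℕ → ℕ → Set
MaxInterval n f m1 m2 k1 k2 =
  (k1 ≤ k2)
  × (∀ l → k1 ≤ l → l ≤ k2 → InD n f m1 m2 l)
  × ¬ InD n f m1 m2 (k1 ∸ 1)
  × ¬ InD n f m1 m2 (suc k2)

AtMostOne : (n : ℕ) → (ℕ → ℕ → ℕ) → ℕ → ℕ → Set
AtMostOne n f m1 m2 = ∀ a b c d →
  MaxInterval n f m1 m2 a b → MaxInterval n f m1 m2 c d → (a , b) ≡ (c , d)

AtMostTwo : (n : ℕ) → (ℕ → ℕ → ℕ) → ℕ → ℕ → Set
AtMostTwo n f m1 m2 = ∀ a b c d e g →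
  MaxInterval n f m1 m2 a b → MaxInterval n f m1 m2 c d → MaxInterval n f m1 m2 e g →
  ((a , b) ≡ (c , d)) ⊎ ((a , b) ≡ (e , g)) ⊎ ((c , d) ≡ (e , g))

ExactlyTwo : (n : ℕ) → (ℕ → ℕ → ℕ) → ℕ → ℕ → Set
ExactlyTwo n f m1 m2 = ∃ λ a → ∃ λ b → ∃ λ c → ∃ λ d →
  MaxInterval n f m1 m2 a b × MaxInterval n f m1 m2 c d × ((a , b) ≢ (c , d))
  × (∀ e g → MaxInterval n f m1 m2 e g → ((e , g) ≡ (a , b)) ⊎ ((e , g) ≡ (c , d)))

C1 : (n h : ℕ) → (ℕ → ℕ → ℕ) → Set
C1 n h f = ∀ m1 m2 → 1 ≤ m1 → m1 ≤ 2 * h → 1 ≤ m2 → m2 ≤ 2 * h →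
  star m1 ≡ m2 → AtMostTwo n f m1 m2

C2 : (n h : ℕ) → (ℕ → ℕ → ℕ) → Set
C2 n h f = ∀ m1 m2 → 1 ≤ m1 → m1 ≤ 2 * h → 1 ≤ m2 → m2 ≤ 2 * h →
  star m1 ≢ m2 → AtMostOne n f m1 m2

-- 2 · med(f_m) = f_m(⌊n/2⌋) + f_m(⌈n/2⌉)
twiceMed : ℕ → (ℕ → ℕ → ℕ) → ℕ → ℕ
twiceMed n f m = f (n / 2) m + f (n ∸ n / 2) m

InAHalf : (n h : ℕ) → (ℕ → ℕ → ℕ) → ℕ → ℕ → Set
InAHalf n h f wbar m = (1 ≤ m) × (m ≤ 2 * h) × (twiceMed n f m ≡ wbar)

SameFn : ℕ → (ℕ → ℕ → ℕ) → ℕ → ℕ → Set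
SameFn n f m m' = ∀ l → l ≤ n → f l m ≡ f l m'

graph : (ℕ → ℕ → ℕ) → ℕ → List ℕ → List (ℕ × ℕ)
graph f m I = map (λ l → (l , f l m)) I

{-# OPTIONS --safe #-}
-- Every f_m ends at f_m(n) = wbar: the point (n - f_m(n), f_m(n)) of the solution lies in M(H),
-- and the only points of M(H) on the line x + y = n come from whole strings, which have weight wbar.
-- So condition (c) reads f_m(l) + f_{m*}(n - l) = wbar, whence f_a and f_b agree on [⌈n/2⌉, n]
-- iff f_{a*} and f_{b*} agree on [0, ⌊n/2⌋]. For a ∈ A(wbar/2) the median forces
-- f_a(⌊n/2⌋) = ⌊wbar/2⌋, so two such functions that differ on both halves have two maximal
-- intervals separated by ⌊n/2⌋, which (C2) forbids unless b = a*. Hence for b ≠ a* either f_a, f_b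
-- or f_{a*}, f_{b*} agree on the left half. If f_m = f_{m*} for every m ∈ A(wbar/2), all these
-- functions coincide. Otherwise take m₁ with f_{m₁} ≠ f_{m₁*}: they differ on both halves, so (C1)
-- leaves exactly two intervals, and comparing any other m with m₁ and m₁* shows that f_m has the
-- left half of f_{m₁} or of f_{m₁*} and equals f_{m*}; so all those f_m coincide.
module Submission where

open import Defs
open import Data.Nat
  using (ℕ; zero; suc; _+_; _*_; _∸_; _≤_; _<_; _⊓_; _≤?_; _≟_; _/_; _%_; ⌊_/2⌋; z≤n; s≤s; s≤s⁻¹; z<s)
open import Data.Nat.Properties hiding (⌊n/2⌋≤n; ⌊n/2⌋≤⌈n/2⌉)
open import Data.Nat.DivMod using (m≡m%n+[m/n]*n; m%n<n; m/n≤m)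
open import Data.Bool using (Bool; true; false)
open import Data.List using (take; drop; length; []; _∷_)
open import Data.List.Properties using (take-all; length-take; length-drop; map-cong-local)
open import Data.List.Membership.Propositional using (_∈_; find; lose)
open import Data.List.Membership.Propositional.Properties
  using (∈-concatMap⁻; ∈-concatMap⁺; ∈-map⁻; ∈-map⁺; ∈-upTo⁺; ∈-upTo⁻)
open import Data.List.Relation.Unary.Any using (here; there)
open import Data.List.Relation.Unary.All using (tabulate)
import Data.List.Relation.Unary.All as List
open import Data.List.Relation.Binary.Permutation.Propositional using (↭-sym)
open import Data.List.Relation.Binary.Permutation.Propositional.Properties using (∈-resp-↭)
open import Data.Vec using (Vec; toList)
open import Data.Vec.Properties using (length-toList)
open import Data.Vec.Relation.Unary.All using (All)
open import Data.Vec.Relation.Unary.All.Properties using (toList⁺)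
open import Data.Product using (_×_; _,_; ∃; ∃₂; proj₁; proj₂)
open import Data.Sum using (_⊎_; inj₁; inj₂; [_,_]′; map₂)
import Data.Sum as Sum
open import Function using (_∘_; id)
open import Relation.Binary.PropositionalEquality
open import Relation.Nullary using (¬_; Dec; yes; no; contradiction)
open import Relation.Nullary.Decidable using (_×-dec_; _→-dec_; ¬?; map′; decidable-stable)
open import Relation.Unary using (Decidable)

-- The multiset M(H) and the end values f_m(n)

∈range⁻ : ∀ {j n} → j ∈ range 1 n → 1 ≤ j × j ≤ n
∈range⁻ p with _ , i∈ , refl ← ∈-map⁻ suc p = z<s , ∈-upTo⁻ i∈

∈range⁺ : ∀ {j n} → 1 ≤ j → j ≤ n → j ∈ range 1 n
∈range⁺ {suc j} _ j≤n = ∈-map⁺ suc (∈-upTo⁺ j≤n)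

wt≤length : ∀ xs → wt xs ≤ length xs
wt≤length [] = z≤n
wt≤length (true ∷ xs) = s≤s (wt≤length xs)
wt≤length (false ∷ xs) = m≤n⇒m≤1+n (wt≤length xs)

module _ {n} (t : Vec Bool n) where

  wt-prefix≤ : ∀ j → wt (prefix j t) ≤ j
  wt-prefix≤ j = begin
    wt (take j (toList t))     ≤⟨ wt≤length (take j (toList t)) ⟩
    length (take j (toList t)) ≡⟨ length-take j (toList t) ⟩
    j ⊓ length (toList t)      ≤⟨ m⊓n≤m j _ ⟩
    j                          ∎
    where open ≤-Reasoning

  wt-suffix≤ : ∀ {j} → j ≤ n → wt (suffix j t) ≤ j
  wt-suffix≤ {j} j≤n = begin
    wt (drop (n ∸ j) (toList t))     ≤⟨ wt≤length (drop (n ∸ j) (toList t)) ⟩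
    length (drop (n ∸ j) (toList t)) ≡⟨ length-drop (n ∸ j) (toList t) ⟩
    length (toList t) ∸ (n ∸ j)      ≡⟨ cong (_∸ (n ∸ j)) (length-toList t) ⟩
    n ∸ (n ∸ j)                      ≡⟨ m∸[m∸n]≡n j≤n ⟩
    j                                ∎
    where open ≤-Reasoning

  prefix-all : prefix n t ≡ toList t
  prefix-all = take-all n (toList t) (≤-reflexive (length-toList t))

  suffix-all : suffix n t ≡ toList t
  suffix-all = cong (λ d → drop d (toList t)) (n∸n≡0 n)

∈Mstr⇒wt : ∀ {n} {t : Vec Bool n} {x w} → (x , w) ∈ Mstr t → x + w ≡ n → w ≡ wt (toList t)
∈Mstr⇒wt {n} {t} p x+w≡n with find (∈-concatMap⁻ _ {xs = range 1 n} p)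
... | j , j∈ , here refl with refl ← trans (sym (m∸n+n≡m (wt-prefix≤ t j))) x+w≡n
  = cong wt (prefix-all t)
... | j , j∈ , there (here refl) with refl ← trans (sym (m∸n+n≡m (wt-suffix≤ t (proj₂ (∈range⁻ j∈))))) x+w≡n
  = cong wt (suffix-all t)

∈MH⇒wbar : ∀ {n h wbar} {H : Vec (Vec Bool n) h} {x w} → All (λ t → wt (toList t) ≡ wbar) H →
           (x , w) ∈ MH H → x + w ≡ n → w ≡ wbar
∈MH⇒wbar {H = H} wts p x+w≡n with t , t∈ , q ← find (∈-concatMap⁻ Mstr {xs = toList H} p)
  = trans (∈Mstr⇒wt q x+w≡n) (List.lookup (toList⁺ wts) t∈)

∈Mf : ∀ {n h} f {l m} → 1 ≤ l → l ≤ n → 1 ≤ m → m ≤ 2 * h → (l ∸ f l m , f l m) ∈ Mf n h f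
∈Mf f 1≤l l≤n 1≤m m≤2h =
  ∈-concatMap⁺ _ (lose (∈range⁺ 1≤m m≤2h) (∈-map⁺ (λ l → (l ∸ f l _ , f l _)) (∈range⁺ 1≤l l≤n)))

solution⇒f[n]≡wbar : ∀ {n h wbar} {H : Vec (Vec Bool n) h} {f} → 1 ≤ n →
  All (λ t → wt (toList t) ≡ wbar) H → CWF n h f → IsSolution n h f (MH H) →
  ∀ m → 1 ≤ m → m ≤ 2 * h → f n m ≡ wbar
solution⇒f[n]≡wbar {h = h} {f = f} 1≤n wts (f≤n , _) sol m 1≤m m≤2h =
  ∈MH⇒wbar wts (∈-resp-↭ (↭-sym sol) (∈Mf {h = h} f 1≤n ≤-refl 1≤m m≤2h))
             (m∸n+n≡m (f≤n _ m ≤-refl 1≤m m≤2h))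

-- Partner indices and the complement law

data OddEven : ℕ → Set where
  odd  : ∀ i → OddEven (suc (2 * i))
  even : ∀ i → OddEven (2 * suc i)

oddEven : ∀ {a} → 1 ≤ a → OddEven a
oddEven {1} _ = odd 0
oddEven {2} _ = even 0
oddEven {suc (suc (suc a))} _ with oddEven {suc a} z<s
... | odd i  = subst OddEven (cong suc (*-suc 2 i)) (odd (suc i))
... | even i = subst OddEven (*-suc 2 (suc i)) (even (suc i))

isEven-2* : ∀ i → isEven (2 * i) ≡ true
isEven-2* zero = refl
isEven-2* (suc i) = trans (cong isEven (*-suc 2 i)) (isEven-2* i)

isEven-1+2* : ∀ i → isEven (suc (2 * i)) ≡ false
isEven-1+2* zero = refl
isEven-1+2* (suc i) = trans (cong (isEven ∘ suc) (*-suc 2 i)) (isEven-1+2* i)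

star-odd : ∀ i → star (suc (2 * i)) ≡ 2 * suc i
star-odd i rewrite isEven-1+2* i = sym (*-suc 2 i)

star-even : ∀ i → star (2 * suc i) ≡ suc (2 * i)
star-even i rewrite isEven-2* (suc i) = cong (_∸ 1) (*-suc 2 i)

star-involutive : ∀ {a} → 1 ≤ a → star (star a) ≡ a
star-involutive 1≤a with oddEven 1≤a
... | odd i  rewrite star-odd i  = star-even i
... | even i rewrite star-even i = star-odd i

star-swap : ∀ {a b} → 1 ≤ a → star a ≡ b → a ≡ star b
star-swap 1≤a a*≡b = trans (sym (star-involutive 1≤a)) (cong star a*≡b)

Index : ℕ → ℕ → Set
Index h a = 1 ≤ a × a ≤ 2 * h

star-index : ∀ {h a} → Index h a → Index h (star a)
star-index {h} (1≤a , a≤2h) with oddEven 1≤a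
... | odd i  rewrite star-odd i  = z<s , *-monoʳ-≤ 2 (*-cancelˡ-< 2 i h a≤2h)
... | even i rewrite star-even i = z<s , ≤-trans (n≤1+n _) (subst (_≤ 2 * h) (*-suc 2 i) a≤2h)

module _ {n h wbar : ℕ} {f : ℕ → ℕ → ℕ} where

  pair-sum≡wbar : CWF n h f → (∀ m → 1 ≤ m → m ≤ 2 * h → f n m ≡ wbar) →
                  ∀ {i} → i < h → ∀ {l} → l ≤ n → f l (suc (2 * i)) + f (n ∸ l) (2 * suc i) ≡ wbar
  pair-sum≡wbar (_ , f₀ , _ , pair-sums) f[n]≡wbar {i} i<h {l} l≤n
    with w , sum≡w ← pair-sums (suc i) z<s i<h = begin
    f l (suc (2 * i)) + f (n ∸ l) (2 * suc i) ≡⟨ sum≡w′ l≤n ⟩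
    w                                         ≡⟨ sum≡w′ z≤n ⟨
    f 0 (suc (2 * i)) + f n (2 * suc i)       ≡⟨ cong₂ _+_ (f₀ _ z<s (*-monoʳ-< 2 i<h))
                                                           (f[n]≡wbar _ z<s (*-monoʳ-≤ 2 i<h)) ⟩
    wbar                                      ∎
    where
    open ≡-Reasoning
    sum≡w′ : ∀ {l} → l ≤ n → f l (suc (2 * i)) + f (n ∸ l) (2 * suc i) ≡ w
    sum≡w′ {l} l≤n =
      subst (λ m → f l m + f (n ∸ l) (2 * suc i) ≡ w) (cong (_∸ 1) (*-suc 2 i)) (sum≡w l l≤n)

  CWF⇒complement : CWF n h f → (∀ m → 1 ≤ m → m ≤ 2 * h → f n m ≡ wbar) →
                   ∀ {a} → Index h a → ∀ {l} → l ≤ n → f l a + f (n ∸ l) (star a) ≡ wbar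
  CWF⇒complement cwf f[n]≡wbar (1≤a , a≤2h) {l} l≤n with oddEven 1≤a
  ... | odd i  rewrite star-odd i  = pair-sum≡wbar cwf f[n]≡wbar (*-cancelˡ-< 2 i h a≤2h) l≤n
  ... | even i rewrite star-even i = begin
    f l (2 * suc i) + f (n ∸ l) (suc (2 * i))             ≡⟨ +-comm (f l (2 * suc i)) _ ⟩
    f (n ∸ l) (suc (2 * i)) + f l (2 * suc i)             ≡⟨ cong (λ x → f (n ∸ l) (suc (2 * i)) + f x (2 * suc i)) n∸[n∸l]≡l ⟨
    f (n ∸ l) (suc (2 * i)) + f (n ∸ (n ∸ l)) (2 * suc i) ≡⟨ pair-sum (m∸n≤m n l) ⟩
    wbar                                                  ∎
    where
    open ≡-Reasoning
    n∸[n∸l]≡l : n ∸ (n ∸ l) ≡ l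
    n∸[n∸l]≡l = m∸[m∸n]≡n l≤n
    pair-sum : ∀ {l} → l ≤ n → f l (suc (2 * i)) + f (n ∸ l) (2 * suc i) ≡ wbar
    pair-sum = pair-sum≡wbar cwf f[n]≡wbar (*-cancelˡ-≤ 2 a≤2h)

-- Runs of a decidable predicate and maximal intervals

AllOn : (ℕ → Set) → ℕ → ℕ → Set
AllOn P i j = ∀ l → i ≤ l → l ≤ j → P l

module _ {P : ℕ → Set} where

  AllOn-single : ∀ {l} → P l → AllOn P l l
  AllOn-single Pl l′ l≤l′ l′≤l = subst P (≤-antisym l≤l′ l′≤l) Pl

  AllOn-join : ∀ {i j i′ j′} → AllOn P i j → AllOn P i′ j′ → i′ ≤ suc j → AllOn P i j′
  AllOn-join left right i′≤1+j l i≤l l≤j′ with l ≤? _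
  ... | yes l≤j = left l i≤l l≤j
  ... | no l≰j  = right l (≤-trans i′≤1+j (≰⇒> l≰j)) l≤j′

  module _ (P? : Decidable P) where

    AllOn? : ∀ i j → Dec (AllOn P i j)
    AllOn? i j = map′ (λ all l i≤l l≤j → all (s≤s l≤j) i≤l)
                      (λ all {l} l<1+j i≤l → all l i≤l (s≤s⁻¹ l<1+j))
                      (allUpTo? (λ l → (i ≤? l) →-dec P? l) (suc j))

    ¬AllOn⇒counterexample : ∀ {i j} → ¬ AllOn P i j → ∃ λ l → i ≤ l × l ≤ j × ¬ P l
    ¬AllOn⇒counterexample {i} {j} ¬all with anyUpTo? (λ l → (i ≤? l) ×-dec ¬? (P? l)) (suc j)
    ... | yes (l , l<1+j , i≤l , ¬Pl) = l , i≤l , s≤s⁻¹ l<1+j , ¬Pl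
    ... | no ∄ = contradiction
      (λ l i≤l l≤j → decidable-stable (P? l) (λ ¬Pl → ∄ (l , s≤s l≤j , i≤l , ¬Pl))) ¬all

    run-right : ∀ d {l} → P l → ¬ P (d + l) → ∃ λ j → l ≤ j × AllOn P l j × ¬ P (suc j)
    run-right zero    Pl ¬Pl = contradiction Pl ¬Pl
    run-right (suc d) {l} Pl ¬Pd+l with P? (suc l)
    ... | no ¬P1+l = l , ≤-refl , AllOn-single Pl , ¬P1+l
    ... | yes P1+l with j , 1+l≤j , run , ¬P1+j ← run-right d P1+l (¬Pd+l ∘ subst P (+-suc d l))
      = j , <⇒≤ 1+l≤j , AllOn-join (AllOn-single Pl) run ≤-refl , ¬P1+j

    run-left : ∀ {l} → ¬ P 0 → P l → ∃ λ i → i ≤ l × AllOn P i l × ¬ P (i ∸ 1)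
    run-left {zero}  ¬P0 P0 = contradiction P0 ¬P0
    run-left {suc l} ¬P0 P1+l with P? l
    ... | no ¬Pl = suc l , ≤-refl , AllOn-single P1+l , ¬Pl
    ... | yes Pl with i , i≤l , run , ¬Pi∸1 ← run-left ¬P0 Pl
      = i , m≤n⇒m≤1+n i≤l , AllOn-join run (AllOn-single P1+l) ≤-refl , ¬Pi∸1

TwoMaxIntervals : (n : ℕ) → (ℕ → ℕ → ℕ) → ℕ → ℕ → Set
TwoMaxIntervals n f m₁ m₂ = ∃₂ λ a b → ∃₂ λ c d →
  MaxInterval n f m₁ m₂ a b × MaxInterval n f m₁ m₂ c d × (a , b) ≢ (c , d)

module _ {n : ℕ} {f : ℕ → ℕ → ℕ} {m₁ m₂ : ℕ} where

  InD? : Decidable (InD n f m₁ m₂)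
  InD? l = (1 ≤? l) ×-dec (l ≤? n) ×-dec ¬? (f l m₁ ≟ f l m₂)

  MaxInterval-around : ∀ {l} → InD n f m₁ m₂ l →
    ∃₂ λ k₁ k₂ → MaxInterval n f m₁ m₂ k₁ k₂ × k₁ ≤ l × l ≤ k₂
  MaxInterval-around {l} Dl
    with k₁ , k₁≤l , run₁ , ¬D[k₁∸1] ← run-left InD? (λ ()) Dl
       | k₂ , l≤k₂ , run₂ , ¬D[1+k₂] ← run-right InD? (suc n) Dl
                                           (λ (_ , 1+n+l≤n , _) → <⇒≱ (m≤m+n (suc n) l) 1+n+l≤n)
    = k₁ , k₂ , (≤-trans k₁≤l l≤k₂ , AllOn-join run₁ run₂ (n≤1+n l) , ¬D[k₁∸1] , ¬D[1+k₂])
    , k₁≤l , l≤k₂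

  separated⇒TwoMaxIntervals : ∀ {l₁ p l₂} → InD n f m₁ m₂ l₁ → InD n f m₁ m₂ l₂ →
    l₁ ≤ p → p ≤ l₂ → ¬ InD n f m₁ m₂ p → TwoMaxIntervals n f m₁ m₂
  separated⇒TwoMaxIntervals D₁ D₂ l₁≤p p≤l₂ ¬Dp
    with a , b , max₁ , a≤l₁ , _ ← MaxInterval-around D₁
       | c , d , max₂ , _ , l₂≤d ← MaxInterval-around D₂
    = a , b , c , d , max₁ , max₂
    , λ { refl → ¬Dp (proj₁ (proj₂ max₁) _ (≤-trans a≤l₁ l₁≤p) (≤-trans p≤l₂ l₂≤d)) }

  AtMostOne⇒¬TwoMaxIntervals : AtMostOne n f m₁ m₂ → ¬ TwoMaxIntervals n f m₁ m₂
  AtMostOne⇒¬TwoMaxIntervals atMostOne (a , b , c , d , max₁ , max₂ , distinct) = distinct (atMostOne a b c d max₁ max₂)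

  AtMostTwo⇒TwoMaxIntervals⇒ExactlyTwo : AtMostTwo n f m₁ m₂ → TwoMaxIntervals n f m₁ m₂ → ExactlyTwo n f m₁ m₂
  AtMostTwo⇒TwoMaxIntervals⇒ExactlyTwo atMostTwo (a , b , c , d , max₁ , max₂ , distinct) =
    a , b , c , d , max₁ , max₂ , distinct , third
    where
    third : ∀ e g → MaxInterval n f m₁ m₂ e g → ((e , g) ≡ (a , b)) ⊎ ((e , g) ≡ (c , d))
    third e g max₃ with atMostTwo a b c d e g max₁ max₂ max₃
    ... | inj₁ same            = contradiction same distinct
    ... | inj₂ (inj₁ ab≡eg)    = inj₁ (sym ab≡eg)
    ... | inj₂ (inj₂ cd≡eg)    = inj₂ (sym cd≡eg)

-- Left and right halves

n∸n/2≡n%2+n/2 : ∀ n → n ∸ n / 2 ≡ n % 2 + n / 2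
n∸n/2≡n%2+n/2 n = +-cancelʳ-≡ (n / 2) _ _ (begin
  n ∸ n / 2 + n / 2             ≡⟨ m∸n+n≡m (m/n≤m n 2) ⟩
  n                             ≡⟨ m≡m%n+[m/n]*n n 2 ⟩
  n % 2 + n / 2 * 2             ≡⟨ cong (n % 2 +_) (*-comm (n / 2) 2) ⟩
  n % 2 + (n / 2 + (n / 2 + 0)) ≡⟨ cong (λ x → n % 2 + (n / 2 + x)) (+-identityʳ (n / 2)) ⟩
  n % 2 + (n / 2 + n / 2)       ≡⟨ +-assoc (n % 2) _ _ ⟨
  n % 2 + n / 2 + n / 2         ∎)
  where open ≡-Reasoning

n∸n/2≡n/2⊎1+n/2 : ∀ n → n ∸ n / 2 ≡ n / 2 ⊎ n ∸ n / 2 ≡ suc (n / 2)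
n∸n/2≡n/2⊎1+n/2 n with n % 2 | m%n<n n 2 | n∸n/2≡n%2+n/2 n
... | 0           | _            | eq = inj₁ eq
... | 1           | _            | eq = inj₂ eq
... | suc (suc _) | s≤s (s≤s ()) | _

⌊m+n/2⌋≡m : ∀ {m n} → n ≡ m ⊎ n ≡ suc m → ⌊ m + n /2⌋ ≡ m
⌊m+n/2⌋≡m {m} (inj₁ refl) = sym (n≡⌊n+n/2⌋ m)
⌊m+n/2⌋≡m {m} (inj₂ refl) = sym (trans (n≡⌈n+n/2⌉ m) (cong ⌊_/2⌋ (sym (+-suc m m))))

complements-agree : ∀ {x y u v w} → x + u ≡ w → y + v ≡ w → u ≡ v → x ≡ y
complements-agree {x} {y} {u} x+u≡w y+v≡w u≡v =
  +-cancelʳ-≡ u x y (trans x+u≡w (trans (sym y+v≡w) (cong (y +_) (sym u≡v))))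

module Halves {n h wbar : ℕ} {f : ℕ → ℕ → ℕ}
  (f₀ : ∀ m → 1 ≤ m → m ≤ 2 * h → f 0 m ≡ 0)
  (step : ∀ l m → 1 ≤ l → l ≤ n → 1 ≤ m → m ≤ 2 * h →
          (f l m ≡ f (l ∸ 1) m) ⊎ (f l m ≡ suc (f (l ∸ 1) m)))
  (complement : ∀ {a} → Index h a → ∀ {l} → l ≤ n → f l a + f (n ∸ l) (star a) ≡ wbar)
  where

  A : ℕ → Set
  A = InAHalf n h f wbar

  A? : Decidable A
  A? m = (1 ≤? m) ×-dec (m ≤? 2 * h) ×-dec (twiceMed n f m ≟ wbar)

  A⇒Index : ∀ {a} → A a → Index h a
  A⇒Index (1≤a , a≤2h , _) = 1≤a , a≤2h

  SelfPaired : ℕ → Set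
  SelfPaired a = SameFn n f a (star a)

  ⌊n/2⌋ ⌈n/2⌉ : ℕ
  ⌊n/2⌋ = n / 2
  ⌈n/2⌉ = n ∸ n / 2

  ⌊n/2⌋≤n : ⌊n/2⌋ ≤ n
  ⌊n/2⌋≤n = m/n≤m n 2

  ⌈n/2⌉≤1+⌊n/2⌋ : ⌈n/2⌉ ≤ suc ⌊n/2⌋
  ⌈n/2⌉≤1+⌊n/2⌋ with n∸n/2≡n/2⊎1+n/2 n
  ... | inj₁ eq = ≤-trans (≤-reflexive eq) (n≤1+n _)
  ... | inj₂ eq = ≤-reflexive eq

  ⌊n/2⌋≤⌈n/2⌉ : ⌊n/2⌋ ≤ ⌈n/2⌉
  ⌊n/2⌋≤⌈n/2⌉ with n∸n/2≡n/2⊎1+n/2 n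
  ... | inj₁ eq = ≤-reflexive (sym eq)
  ... | inj₂ eq = ≤-trans (n≤1+n _) (≤-reflexive (sym eq))

  n∸⌈n/2⌉≡⌊n/2⌋ : n ∸ ⌈n/2⌉ ≡ ⌊n/2⌋
  n∸⌈n/2⌉≡⌊n/2⌋ = m∸[m∸n]≡n ⌊n/2⌋≤n

  median-step : ∀ {a} → Index h a → f ⌈n/2⌉ a ≡ f ⌊n/2⌋ a ⊎ f ⌈n/2⌉ a ≡ suc (f ⌊n/2⌋ a)
  median-step {a} (1≤a , a≤2h) with n∸n/2≡n/2⊎1+n/2 n
  ... | inj₁ eq = inj₁ (cong (λ l → f l a) eq)
  ... | inj₂ eq = subst (λ l → f l a ≡ f ⌊n/2⌋ a ⊎ f l a ≡ suc (f ⌊n/2⌋ a)) (sym eq)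
                        (step (suc ⌊n/2⌋) a z<s (subst (_≤ n) eq (m∸n≤m n ⌊n/2⌋)) 1≤a a≤2h)

  A⇒f[⌊n/2⌋]≡⌊wbar/2⌋ : ∀ {a} → A a → f ⌊n/2⌋ a ≡ ⌊ wbar /2⌋
  A⇒f[⌊n/2⌋]≡⌊wbar/2⌋ (1≤a , a≤2h , med) =
    trans (sym (⌊m+n/2⌋≡m (median-step (1≤a , a≤2h)))) (cong ⌊_/2⌋ med)

  A-star : ∀ {a} → A a → A (star a)
  A-star {a} (1≤a , a≤2h , med) with 1≤a* , a*≤2h ← star-index {h} (1≤a , a≤2h) =
    1≤a* , a*≤2h , trans (cong₂ _+_ ⌊n/2⌋-values ⌈n/2⌉-values) med
    where
    ⌈n/2⌉-values : f ⌈n/2⌉ (star a) ≡ f ⌈n/2⌉ a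
    ⌈n/2⌉-values = +-cancelˡ-≡ (f ⌊n/2⌋ a) _ _ (trans (complement (1≤a , a≤2h) ⌊n/2⌋≤n) (sym med))
    ⌊n/2⌋-values : f ⌊n/2⌋ (star a) ≡ f ⌊n/2⌋ a
    ⌊n/2⌋-values = +-cancelˡ-≡ (f ⌈n/2⌉ a) _ _ (begin
      f ⌈n/2⌉ a + f ⌊n/2⌋ (star a)           ≡⟨ cong (λ l → f ⌈n/2⌉ a + f l (star a)) n∸⌈n/2⌉≡⌊n/2⌋ ⟨
      f ⌈n/2⌉ a + f (n ∸ ⌈n/2⌉) (star a)     ≡⟨ complement (1≤a , a≤2h) (m∸n≤m n ⌊n/2⌋) ⟩
      wbar                                   ≡⟨ med ⟨
      f ⌊n/2⌋ a + f ⌈n/2⌉ a                  ≡⟨ +-comm (f ⌊n/2⌋ a) _ ⟩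
      f ⌈n/2⌉ a + f ⌊n/2⌋ a                  ∎)
      where open ≡-Reasoning

  complement-star : ∀ {a} → Index h a → ∀ {l} → l ≤ n → f l (star a) + f (n ∸ l) a ≡ wbar
  complement-star {a} (1≤a , a≤2h) {l} l≤n =
    subst (λ b → f l (star a) + f (n ∸ l) b ≡ wbar) (star-involutive 1≤a)
          (complement (star-index {h} (1≤a , a≤2h)) l≤n)

  Agree : ℕ → ℕ → ℕ → Set
  Agree a b l = f l a ≡ f l b

  Agree? : ∀ a b → Decidable (Agree a b)
  Agree? a b l = f l a ≟ f l b

  AgreeLeft AgreeRight : ℕ → ℕ → Set
  AgreeLeft a b = AllOn (Agree a b) 0 ⌊n/2⌋
  AgreeRight a b = AllOn (Agree a b) ⌈n/2⌉ n

  AgreeLeft-sym : ∀ {a b} → AgreeLeft a b → AgreeLeft b a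
  AgreeLeft-sym a~b l 0≤l l≤k = sym (a~b l 0≤l l≤k)

  AgreeLeft-trans : ∀ {a b c} → AgreeLeft a b → AgreeLeft b c → AgreeLeft a c
  AgreeLeft-trans a~b b~c l 0≤l l≤k = trans (a~b l 0≤l l≤k) (b~c l 0≤l l≤k)

  SameFn⇒AgreeLeft : ∀ {a b} → SameFn n f a b → AgreeLeft a b
  SameFn⇒AgreeLeft a≡b l _ l≤k = a≡b l (≤-trans l≤k ⌊n/2⌋≤n)

  SameFn? : ∀ a b → Dec (SameFn n f a b)
  SameFn? a b = map′ (λ all l l≤n → all l z≤n l≤n) (λ a≡b l _ l≤n → a≡b l l≤n) (AllOn? (Agree? a b) 0 n)

  AgreeRight⇒AgreeLeft-star : ∀ {a b} → Index h a → Index h b → AgreeRight a b → AgreeLeft (star a) (star b)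
  AgreeRight⇒AgreeLeft-star ia ib right l _ l≤k =
    complements-agree (complement-star ia l≤n) (complement-star ib l≤n)
      (right (n ∸ l) (∸-monoʳ-≤ n l≤k) (m∸n≤m n l))
    where
    l≤n : l ≤ n
    l≤n = ≤-trans l≤k ⌊n/2⌋≤n

  AgreeLeft-star⇒AgreeRight : ∀ {a b} → Index h a → Index h b → AgreeLeft (star a) (star b) → AgreeRight a b
  AgreeLeft-star⇒AgreeRight ia ib left l k′≤l l≤n =
    complements-agree (complement ia l≤n) (complement ib l≤n)
      (left (n ∸ l) z≤n (subst (n ∸ l ≤_) n∸⌈n/2⌉≡⌊n/2⌋ (∸-monoʳ-≤ n k′≤l)))

  AgreeLeft-both⇒SameFn : ∀ {a b} → Index h a → Index h b →
    AgreeLeft a b → AgreeLeft (star a) (star b) → SameFn n f a b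
  AgreeLeft-both⇒SameFn ia ib left left* l l≤n with l ≤? ⌊n/2⌋
  ... | yes l≤k = left l z≤n l≤k
  ... | no l≰k  = AgreeLeft-star⇒AgreeRight ia ib left* l (≤-trans ⌈n/2⌉≤1+⌊n/2⌋ (≰⇒> l≰k)) l≤n

  AgreeLeft-self-star⇒SelfPaired : ∀ {a} → Index h a → AgreeLeft a (star a) → SelfPaired a
  AgreeLeft-self-star⇒SelfPaired {a} ia left =
    AgreeLeft-both⇒SameFn ia (star-index {h} ia) left
      (subst (AgreeLeft (star a)) (sym (star-involutive (proj₁ ia))) (AgreeLeft-sym left))

  AgreeLeft⇒graph≡ : ∀ {a b} → AgreeLeft a b → graph f a (range 1 ⌊n/2⌋) ≡ graph f b (range 1 ⌊n/2⌋)
  AgreeLeft⇒graph≡ left = map-cong-local (tabulate λ l∈ → cong (_ ,_) (left _ z≤n (proj₂ (∈range⁻ l∈))))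

  disagree⇒InD : ∀ {a b l} → Index h a → Index h b → l ≤ n → ¬ Agree a b l → InD n f a b l
  disagree⇒InD {l = zero}  (1≤a , a≤2h) (1≤b , b≤2h) _ a≁b =
    contradiction (trans (f₀ _ 1≤a a≤2h) (sym (f₀ _ 1≤b b≤2h))) a≁b
  disagree⇒InD {l = suc _} _ _ l≤n a≁b = z<s , l≤n , a≁b

  disagree-both-halves⇒TwoMaxIntervals : ∀ {a b} → A a → A b →
    ¬ AgreeLeft a b → ¬ AgreeRight a b → TwoMaxIntervals n f a b
  disagree-both-halves⇒TwoMaxIntervals {a} {b} A-a A-b ¬left ¬right
    with l₁ , _ , l₁≤k , a≁b₁ ← ¬AllOn⇒counterexample (Agree? a b) ¬left
       | l₂ , k′≤l₂ , l₂≤n , a≁b₂ ← ¬AllOn⇒counterexample (Agree? a b) ¬right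
    = separated⇒TwoMaxIntervals {n} {f}
        (disagree⇒InD ia ib (≤-trans l₁≤k ⌊n/2⌋≤n) a≁b₁) (disagree⇒InD ia ib l₂≤n a≁b₂)
        l₁≤k (≤-trans ⌊n/2⌋≤⌈n/2⌉ k′≤l₂)
        (λ (_ , _ , a≁b) → a≁b (trans (A⇒f[⌊n/2⌋]≡⌊wbar/2⌋ A-a) (sym (A⇒f[⌊n/2⌋]≡⌊wbar/2⌋ A-b))))
    where
    ia : Index h a
    ia = A⇒Index A-a
    ib : Index h b
    ib = A⇒Index A-b

  module _ (c2 : C2 n h f) where

    C2⇒AgreeLeft⊎AgreeLeft-star : ∀ {a b} → A a → A b → star a ≢ b → AgreeLeft a b ⊎ AgreeLeft (star a) (star b)
    C2⇒AgreeLeft⊎AgreeLeft-star {a} {b} A-a@(1≤a , a≤2h , _) A-b@(1≤b , b≤2h , _) a*≢b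
      with AllOn? (Agree? a b) 0 ⌊n/2⌋ | AllOn? (Agree? a b) ⌈n/2⌉ n
    ... | yes left | _         = inj₁ left
    ... | no _     | yes right = inj₂ (AgreeRight⇒AgreeLeft-star (1≤a , a≤2h) (1≤b , b≤2h) right)
    ... | no ¬left | no ¬right =
      contradiction (disagree-both-halves⇒TwoMaxIntervals A-a A-b ¬left ¬right)
                    (AtMostOne⇒¬TwoMaxIntervals {n} {f} (c2 a b 1≤a a≤2h 1≤b b≤2h a*≢b))

    SelfPaired⇒SameFn : ∀ {a b} → A a → A b → SelfPaired a → SelfPaired b → SameFn n f a b
    SelfPaired⇒SameFn {a} {b} A-a A-b a≡a* b≡b* with star a ≟ b
    ... | yes refl = a≡a*
    ... | no a*≢b  = AgreeLeft-both⇒SameFn (A⇒Index A-a) (A⇒Index A-b) left (star-side left)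
      where
      a~a* : AgreeLeft a (star a)
      a~a* = SameFn⇒AgreeLeft a≡a*
      b~b* : AgreeLeft b (star b)
      b~b* = SameFn⇒AgreeLeft b≡b*
      star-side : AgreeLeft a b → AgreeLeft (star a) (star b)
      star-side a~b = AgreeLeft-trans (AgreeLeft-sym a~a*) (AgreeLeft-trans a~b b~b*)
      left : AgreeLeft a b
      left = [ id , (λ a*~b* → AgreeLeft-trans a~a* (AgreeLeft-trans a*~b* (AgreeLeft-sym b~b*))) ]′
               (C2⇒AgreeLeft⊎AgreeLeft-star A-a A-b a*≢b)

    unpaired-index : ¬ (∀ m m′ → A m → A m′ → SameFn n f m m′) → ∃ λ P → A P × ¬ SelfPaired P
    unpaired-index not-all-same
      with anyUpTo? (λ m → A? m ×-dec ¬? (SameFn? m (star m))) (suc (2 * h))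
    ... | yes (P , _ , A-P , P≢P*) = P , A-P , P≢P*
    ... | no none = contradiction
      (λ m m′ A-m A-m′ → SelfPaired⇒SameFn A-m A-m′ (self-paired A-m) (self-paired A-m′)) not-all-same
      where
      self-paired : ∀ {m} → A m → SelfPaired m
      self-paired {m} A-m@(_ , m≤2h , _) =
        decidable-stable (SameFn? m (star m)) (λ m≢m* → none (m , s≤s m≤2h , A-m , m≢m*))

    module Unpaired (c1 : C1 n h f) {P} (A-P : A P) (P≢P* : ¬ SelfPaired P) where

      iP : Index h P
      iP = A⇒Index A-P

      P**≡P : star (star P) ≡ P
      P**≡P = star-involutive (proj₁ iP)

      ¬AgreeLeft-P : ¬ AgreeLeft P (star P)
      ¬AgreeLeft-P = P≢P* ∘ AgreeLeft-self-star⇒SelfPaired iP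

      ¬AgreeRight-P : ¬ AgreeRight P (star P)
      ¬AgreeRight-P right = ¬AgreeLeft-P (AgreeLeft-sym (subst (AgreeLeft (star P)) P**≡P
                                (AgreeRight⇒AgreeLeft-star iP (star-index {h} iP) right)))

      exactly-two : ExactlyTwo n f P (star P)
      exactly-two = AtMostTwo⇒TwoMaxIntervals⇒ExactlyTwo {n} {f}
        (c1 P (star P) (proj₁ iP) (proj₂ iP) (proj₁ iP*) (proj₂ iP*) refl)
        (disagree-both-halves⇒TwoMaxIntervals A-P (A-star A-P) ¬AgreeLeft-P ¬AgreeRight-P)
        where
        iP* : Index h (star P)
        iP* = star-index {h} iP

      Other : ℕ → Set
      Other m = A m × m ≢ P × m ≢ star P

      other-sides : ∀ {m} → Other m → AgreeLeft m (star m) × (AgreeLeft m P ⊎ AgreeLeft m (star P))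
      other-sides {m} (A-m@(1≤m , _) , m≢P , m≢P*)
        with C2⇒AgreeLeft⊎AgreeLeft-star A-m A-P (m≢P* ∘ star-swap 1≤m)
           | map₂ (subst (AgreeLeft (star m)) P**≡P)
               (C2⇒AgreeLeft⊎AgreeLeft-star A-m (A-star A-P) (λ m*≡P* → m≢P (trans (star-swap 1≤m m*≡P*) P**≡P)))
      ... | inj₁ m~P   | inj₁ m~P*  = contradiction (AgreeLeft-trans (AgreeLeft-sym m~P) m~P*) ¬AgreeLeft-P
      ... | inj₁ m~P   | inj₂ m*~P  = AgreeLeft-trans m~P (AgreeLeft-sym m*~P) , inj₁ m~P
      ... | inj₂ m*~P* | inj₁ m~P*  = AgreeLeft-trans m~P* (AgreeLeft-sym m*~P*) , inj₂ m~P*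
      ... | inj₂ m*~P* | inj₂ m*~P  = contradiction (AgreeLeft-trans (AgreeLeft-sym m*~P) m*~P*) ¬AgreeLeft-P

      others-same : ∀ m m′ → A m → m ≢ P → m ≢ star P →
                    A m′ → m′ ≢ P → m′ ≢ star P → SameFn n f m m′
      others-same m m′ A-m m≢P m≢P* A-m′ m′≢P m′≢P* =
        SelfPaired⇒SameFn A-m A-m′ (self-paired (A-m , m≢P , m≢P*)) (self-paired (A-m′ , m′≢P , m′≢P*))
        where
        self-paired : ∀ {m} → Other m → SelfPaired m
        self-paired other@(A-m , _) = AgreeLeft-self-star⇒SelfPaired (A⇒Index A-m) (proj₁ (other-sides other))

      Other? : Decidable Other
      Other? m = A? m ×-dec ¬? (m ≟ P) ×-dec ¬? (m ≟ star P)

      others-graph≡ : ∀ {m₀ b} → Other m₀ → AgreeLeft m₀ b →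
        ∀ m → A m → m ≢ P → m ≢ star P → graph f m (range 1 ⌊n/2⌋) ≡ graph f b (range 1 ⌊n/2⌋)
      others-graph≡ (A-m₀ , m₀≢P , m₀≢P*) m₀~b m A-m m≢P m≢P* =
        AgreeLeft⇒graph≡ (AgreeLeft-trans (SameFn⇒AgreeLeft (others-same m _ A-m m≢P m≢P* A-m₀ m₀≢P m₀≢P*))
                                          m₀~b)

      others-graph :
          (∀ m → A m → m ≢ P → m ≢ star P → graph f m (range 1 ⌊n/2⌋) ≡ graph f P (range 1 ⌊n/2⌋))
        ⊎ (∀ m → A m → m ≢ P → m ≢ star P → graph f m (range 1 ⌊n/2⌋) ≡ graph f (star P) (range 1 ⌊n/2⌋))
      others-graph with anyUpTo? Other? (suc (2 * h))
      ... | yes (_ , _ , other₀) = Sum.map (others-graph≡ other₀) (others-graph≡ other₀) (proj₂ (other-sides other₀))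
      ... | no none = inj₁ λ m A-m@(_ , m≤2h , _) m≢P m≢P* → contradiction (m , s≤s m≤2h , A-m , m≢P , m≢P*) none

lemma5 : (n h wbar : ℕ) → 1 ≤ n → 1 ≤ h → wbar ≤ n →
    (H : Vec (Vec Bool n) h) →
    All (λ t → wt (toList t) ≡ wbar) H →
    (f : ℕ → ℕ → ℕ) →
    CWF n h f →
    IsSolution n h f (MH H) →
    C1 n h f → C2 n h f →
    ¬ (∀ m m' → InAHalf n h f wbar m → InAHalf n h f wbar m' → SameFn n f m m') →
    ∃ λ m1 → InAHalf n h f wbar m1
      × ExactlyTwo n f m1 (star m1)
      × (∀ m m' → InAHalf n h f wbar m → m ≢ m1 → m ≢ star m1 →
                  InAHalf n h f wbar m' → m' ≢ m1 → m' ≢ star m1 →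
                  SameFn n f m m')
      × ((∀ m → InAHalf n h f wbar m → m ≢ m1 → m ≢ star m1 →
                graph f m (range 1 (n / 2)) ≡ graph f m1 (range 1 (n / 2)))
         ⊎ (∀ m → InAHalf n h f wbar m → m ≢ m1 → m ≢ star m1 →
                graph f m (range 1 (n / 2)) ≡ graph f (star m1) (range 1 (n / 2))))
lemma5 _ h _ 1≤n _ _ _ wts _ cwf@(_ , f₀ , step , _) sol c1 c2 not-all-same =
  let open Halves {h = h} f₀ step (CWF⇒complement cwf (solution⇒f[n]≡wbar 1≤n wts cwf sol))
      P , A-P , P≢P* = unpaired-index c2 not-all-same
      open Unpaired c2 c1 A-P P≢P*
  in P , A-P , exactly-two , others-same , others-graph
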